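{- Let $\mathcal S$ be an infinite sequence of elementary foldings and $P_{\mathcal S}$ its folding pattern. Then at every vertex $v$ of the grid $\mathcal L$, among the six unit edges incident to $v$, two consecutive ones (forming an angle $\pi/3$) have one color and the other four have the other color.
   Context: Grid: let $\xi_1=(0,-2\sqrt3)$ and let $\xi_2,\xi_3$ be its counterclockwise rotations by $2\pi/3$ and $4\pi/3$. For $i\in\{1,2,3\}$, $n\in\mathbb Z$ put $\ell_{i,n}=\{x\in\mathbb R^2:(x,\xi_i)=3n+1\}$. The union $\mathcal L$ of all $\ell_{i,n}$ is a triangular grid whose smallest triangles (unit triangles) are regular of side $1$; unit edges are the sides of unit triangles. $O$ is the origin and $T_0$ is the positive (vertex above its horizontal side) unit triangle centered at $O$; $(-2)^kT_0$ is its image under the homothety with center $O$ and ratio $(-2)^k$, a grid triangle of side $2^k$. Folding patterns: an elementary folding folds a paper regular triangle of side $2a$ along its three midsegments onto its central triangle of side $a$; it is a folding up ($+$) if all three folds go through the upper half-space of $\mathbb R^3$ and a folding down ($-$) if all go through the lower half-space. When unfolded, fold lines of a folding up become valleys and those of a folding down become peaks. For a finite sequence $(a_1,\dots,a_k)$ take the paper triangle $(-2)^kT_0$, perform $a_k$ first (onto $(-2)^{k-1}T_0$), then $a_{k-1}$, …, finally $a_1$ (onto $T_0$), then unfold; valleys are colored red and peaks blue, giving a coloring of the unit edges interior to $(-2)^kT_0$. For an infinite sequence $\mathcal S=(a_i)_{i\ge1}$ of symbols $\pm$, $P_{\mathcal S}$ is the red/blue coloring of all unit edges of $\mathcal L$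 in which each edge gets its color from the pattern of $(a_1,\dots,a_k)$ for any $k$ with the edge interior to $(-2)^kT_0$ (independent of $k$). -}

module Defs where

open import Data.Nat as ℕ using (ℕ; zero; suc)
open import Data.Integer using (ℤ; +_; -[1+_]; _+_; _-_; _*_; -_; _^_; _<_; ∣_∣)
open import Data.Integer.Properties using (_≟_; _<?_)
open import Data.Bool using (Bool; true; false; if_then_else_; _∧_; _∨_; not; _xor_)
open import Data.Maybe using (Maybe; just; nothing)
open import Data.Fin using (Fin; zero; suc)
open import Data.Product using (Σ; _×_; _,_; proj₁; proj₂)
open import Relation.Nullary.Decidable using (⌊_⌋)
open import Relation.Binary.PropositionalEquality using (_≡_)

-- A point x of the plane is recorded by u_i = (x , ξ_i), i = 1,2,3;
-- u_1 + u_2 + u_3 = 0 and (u_1 , u_2) determine x.  The grid lines are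
-- u_i = 3n+1.  To keep midpoints of unit edges integral we work with
-- DOUBLED coordinates P_i = 2 u_i.

record Pt : Set where
  constructor pt
  field
    p₁ p₂ p₃ : ℤ
open Pt public

OneMod3 : ℤ → Set
OneMod3 u = Σ ℤ (λ n → u ≡ + 3 * n + + 1)

-- A vertex of the grid 𝓛 (in ordinary, non-doubled coordinates):
-- a point lying on grid lines, i.e. all u_i ≡ 1 mod 3.
record Vertex : Set where
  field
    u₁ u₂ u₃ : ℤ
    sum0 : u₁ + u₂ + u₃ ≡ + 0
    on₁  : OneMod3 u₁
    on₂  : OneMod3 u₂
    on₃  : OneMod3 u₃
open Vertex public

-- The six unit edges at a vertex, in counterclockwise cyclic order
-- (directions of angle 0, π/3, 2π/3, π, 4π/3, 5π/3).
dir : Fin 6 → Pt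
dir zero                               = pt (+ 0) (+ 3) (- + 3)
dir (suc zero)                         = pt (- + 3) (+ 3) (+ 0)
dir (suc (suc zero))                   = pt (- + 3) (+ 0) (+ 3)
dir (suc (suc (suc zero)))             = pt (+ 0) (- + 3) (+ 3)
dir (suc (suc (suc (suc zero))))       = pt (+ 3) (- + 3) (+ 0)
dir (suc (suc (suc (suc (suc zero))))) = pt (+ 3) (+ 0) (- + 3)

next : Fin 6 → Fin 6
next zero                               = suc zero
next (suc zero)                         = suc (suc zero)
next (suc (suc zero))                   = suc (suc (suc zero))
next (suc (suc (suc zero)))             = suc (suc (suc (suc zero)))
next (suc (suc (suc (suc zero))))       = suc (suc (suc (suc (suc zero))))
next (suc (suc (suc (suc (suc zero))))) = zero

-- A unit edge is represented by its midpoint in doubled coordinates.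
-- The edge at vertex v in direction s has doubled midpoint 2v + dir s.
edgeAt : Vertex → Fin 6 → Pt
edgeAt v s = pt (+ 2 * u₁ v + p₁ (dir s)) (+ 2 * u₂ v + p₂ (dir s)) (+ 2 * u₃ v + p₃ (dir s))

data Sign : Set where
  up down : Sign

data Color : Set where
  red blue : Color         -- red = valley, blue = peak

flip : Color → Color
flip red  = blue
flip blue = red

pow : ℕ → ℤ
pow j = (- + 2) ^ j

-- (-2)^k T₀ = { u : t u_i ≤ t² for all i }, t = (-2)^k.
-- A unit edge is interior to (-2)^k T₀ iff its midpoint is in the open
-- triangle: t u_i < t², i.e. (doubled) t P_i < 2 t².
interior : ℕ → Pt → Bool
interior k (pt a b c) =
  ⌊ t * a <? + 2 * (t * t) ⌋ ∧ ⌊ t * b <? + 2 * (t * t) ⌋ ∧ ⌊ t * c <? + 2 * (t * t) ⌋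
  where t = pow k

-- Colour of a crease made by a folding of sign a on a layer whose current
-- orientation is `flipped` (odd number of reflections so far):
-- on a face-up layer folding up gives a valley, folding down a peak;
-- on a face-down layer it is the opposite.
creaseColor : Sign → Bool → Color
creaseColor up   false = red
creaseColor up   true  = blue
creaseColor down false = blue
creaseColor down true  = red

-- Elementary folding of (-2)^j T₀ onto its central triangle (-2)^(j-1) T₀,
-- with m = (-2)^(j-1).  The midsegments are the lines u_i = m (P_i = 2m);
-- corner i is { m u_i > m² } and is reflected in u_i = m:
--   u_i ↦ 2m − u_i ,  u_l ↦ u_l + u_i − m  (l ≠ i).
onCrease : ℤ → Pt → Bool
onCrease m (pt a b c) = ⌊ a ≟ + 2 * m ⌋ ∨ ⌊ b ≟ + 2 * m ⌋ ∨ ⌊ c ≟ + 2 * m ⌋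

inCorner : ℤ → ℤ → Bool
inCorner m a = ⌊ + 2 * (m * m) <? m * a ⌋

-- result: new point and whether a reflection happened
foldStep : ℤ → Pt → Pt × Bool
foldStep m (pt a b c) =
  if inCorner m a then (pt (+ 4 * m - a) (b + a - + 2 * m) (c + a - + 2 * m) , true)
  else if inCorner m b then (pt (a + b - + 2 * m) (+ 4 * m - b) (c + b - + 2 * m) , true)
  else if inCorner m c then (pt (a + c - + 2 * m) (b + c - + 2 * m) (+ 4 * m - c) , true)
  else (pt a b c , false)

-- A sequence of elementary foldings: S i is the symbol a_(i+1)
-- (so a_1 = S 0, a_2 = S 1, ...).
Seq : Set
Seq = ℕ → Sign

-- Perform the foldings a_j, a_(j-1), ..., a_1 on a point P of (-2)^j T₀
-- (current orientation `o`), and return the colour of the crease made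
-- through P, if any.  Folding a_j maps (-2)^j T₀ onto (-2)^(j-1) T₀ and
-- its midsegments are u_i = (-2)^(j-1).
run : Seq → ℕ → Pt → Bool → Maybe Color
run S zero    P o = nothing
run S (suc j) P o =
  if onCrease (pow j) P then just (creaseColor (S j) o)
  else run S j (proj₁ (foldStep (pow j) P)) (o xor proj₂ (foldStep (pow j) P))

foldPattern : ℕ → Seq → Pt → Maybe Color
foldPattern k S e = if interior k e then run S k e false else nothing

-- A k for which the edge e is interior to (-2)^k T₀
-- (2^k > |P₁|+|P₂|+|P₃| ≥ 2 max |u_i|).
κ : Pt → ℕ
κ (pt a b c) = suc (∣ a ∣ ℕ.+ ∣ b ∣ ℕ.+ ∣ c ∣)

-- The folding pattern P_S (by the independence of k, any k with the edge
-- interior may be used; we use κ e).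
P : Seq → Pt → Maybe Color
P S e = foldPattern (κ e) S e

module Submission where

-- Measured in barycentric coordinates of the triangle being folded, scaled so that
-- (-2)^(j+1) T₀ becomes { x₁ + x₂ + x₃ = 2^(j+1), xᵢ ≥ 0 }, every elementary folding acts
-- alike: corner i is reflected in its midsegment xᵢ = 2^j and the central triangle is
-- turned by a half-turn; the alternating signs of (-2)^j disappear.
-- A vertex inside a corner or inside the central triangle is carried with its six edges to
-- a vertex one level down, by a symmetry of the hexagon of directions; such symmetries
-- keep "a consecutive pair of one colour, the other four of the other".  A vertex on a
-- midsegment has its two crease edges of the crease colour d; its other four edges land on
-- the two inward edges of a single boundary vertex one level down, two of them after a
-- reflection, which reverses colours.  Those two inward edges share a colour c (a second
-- induction along the boundary), so the four edges are c, c, flip c, flip c, and together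
-- with the crease edges this is the pattern whether d is c or flip c.  Finally the level is
-- taken so large that all six edges are interior, where the pattern does not depend on it.

open import Defs
open import Data.Fin using (Fin)
open import Data.Product using (Σ; _×_)
open import Data.Sum using (_⊎_)
open import Data.Maybe using (just)
open import Relation.Nullary using (¬_)
open import Relation.Binary.PropositionalEquality using (_≡_)

open import Data.Bool using (Bool; true; false; if_then_else_; _∨_; not; _xor_)
import Data.Bool as Bool
open import Data.Bool.Properties using (∧-conicalˡ; ∧-conicalʳ; ∨-zeroʳ; xor-comm; true-xor; xor-identityʳ)
open import Data.Empty using (⊥; ⊥-elim)
import Data.Fin as Fin
open import Data.Fin.Patterns using (0F; 1F; 2F; 3F; 4F; 5F)
open import Data.Fin.Properties using (all?)
open import Data.Integer using (ℤ; +_; -[1+_]; _+_; _-_; _*_; -_; _<_; _≤_; +<+; +≤+; -≤+; ∣_∣)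
import Data.Integer as ℤ
import Data.Integer.Properties as ℤ
open import Data.Integer.Properties using (_≟_; _<?_)
open import Data.Integer.Tactic.RingSolver using (solve-∀; solve)
open import Data.List using (_∷_; [])
open import Data.Maybe using (Maybe; nothing)
import Data.Maybe as Maybe
open import Data.Nat as ℕ using (ℕ; zero; suc; z≤n; s≤s; _≤′_; ≤′-refl; ≤′-step)
import Data.Nat.Properties as ℕ
open import Algebra.Properties.CommutativeMonoid.Sum ℕ.+-0-commutativeMonoid using (sum; sum-remove)
open import Data.Product using (_,_; proj₁; proj₂)
open import Data.Sum using (inj₁; inj₂)
open import Data.Unit using (⊤; tt)
open import Function using (_∘_; _⇔_; mk⇔)
open import Function.Bundles using (module Equivalence)
open import Relation.Binary.Definitions using (tri<; tri≈; tri>)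
open import Relation.Binary.PropositionalEquality using (refl; sym; trans; cong; cong₂; subst; subst₂; _≢_; module ≡-Reasoning)
open import Relation.Nullary using (Dec; yes)
open import Relation.Nullary.Decidable using (⌊_⌋; _×-dec_; isYes≗does; dec-true; dec-false; does-⇔; from-yes)

0≤-+ : ∀ {a b} → + 0 ≤ a → + 0 ≤ b → + 0 ≤ a + b
0≤-+ = ℤ.+-mono-≤

<⇒0≤gap : ∀ {a b} → a < b → + 0 ≤ b - (+ 1 + a)
<⇒0≤gap h = ℤ.i≤j⇒0≤j-i (ℤ.i<j⇒suc[i]≤j h)

0≤gap⇒< : ∀ {a b} → + 0 ≤ b - (+ 1 + a) → a < b
0≤gap⇒< h = ℤ.suc[i]≤j⇒i<j (ℤ.0≤i-j⇒j≤i h)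

≡⇒0≤- : ∀ {a b} → a ≡ b → + 0 ≤ b - a
≡⇒0≤- {a} refl = ℤ.≤-reflexive (sym (ℤ.i≡j⇒i-j≡0 {a} refl))

<⇔0<- : ∀ {a b} → a < b ⇔ + 0 < b - a
<⇔0<- {a} {b} = mk⇔ (λ h → 0≤gap⇒< (subst (+ 0 ≤_) (shift a b) (<⇒0≤gap h)))
                    (λ h → 0≤gap⇒< (subst (+ 0 ≤_) (sym (shift a b)) (<⇒0≤gap h)))
  where
  shift : ∀ a b → b - (+ 1 + a) ≡ (b - a) - (+ 1 + + 0)
  shift = solve-∀

<⇔<-by-multiple : ∀ {a b c d} k → + 0 < k → b - a ≡ k * (d - c) → a < b ⇔ c < d
<⇔<-by-multiple {a} {b} {c} {d} k 0<k e = mk⇔ forth back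
  where
  k*0≡0 : k * + 0 ≡ + 0
  k*0≡0 = ℤ.*-zeroʳ k
  forth : a < b → c < d
  forth h = Equivalence.from <⇔0<- (ℤ.*-cancelˡ-<-nonNeg k {{ℤ.nonNegative (ℤ.<⇒≤ 0<k)}}
              (subst₂ _<_ (sym k*0≡0) e (Equivalence.to <⇔0<- h)))
  back : c < d → a < b
  back h = Equivalence.from <⇔0<- (subst₂ _<_ k*0≡0 (sym e)
             (ℤ.*-monoˡ-<-pos k {{ℤ.positive 0<k}} (Equivalence.to <⇔0<- h)))

≡⇔≡-by-multiple : ∀ {a b c d} k → k ≢ + 0 → b - a ≡ k * (d - c) → a ≡ b ⇔ c ≡ d
≡⇔≡-by-multiple {a} {b} {c} {d} k k≢0 e = mk⇔ forth back
  where
  forth : a ≡ b → c ≡ d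
  forth refl with ℤ.i*j≡0⇒i≡0∨j≡0 k (trans (sym e) (ℤ.i≡j⇒i-j≡0 {a} refl))
  ... | inj₁ k≡0 = ⊥-elim (k≢0 k≡0)
  ... | inj₂ d-c≡0 = sym (ℤ.i-j≡0⇒i≡j d c d-c≡0)
  back : c ≡ d → a ≡ b
  back refl = sym (ℤ.i-j≡0⇒i≡j b a (trans e (trans (cong (k *_) (ℤ.i≡j⇒i-j≡0 {c} refl)) (ℤ.*-zeroʳ k))))

isYes-⇔ : ∀ {A B : Set} → A ⇔ B → (a? : Dec A) (b? : Dec B) → ⌊ a? ⌋ ≡ ⌊ b? ⌋
isYes-⇔ A⇔B a? b? = trans (isYes≗does a?) (trans (does-⇔ A⇔B a? b?) (sym (isYes≗does b?)))

isYes-true : ∀ {A : Set} (a? : Dec A) → A → ⌊ a? ⌋ ≡ true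
isYes-true a? a = trans (isYes≗does a?) (dec-true a? a)

isYes-false : ∀ {A : Set} (a? : Dec A) → ¬ A → ⌊ a? ⌋ ≡ false
isYes-false a? ¬a = trans (isYes≗does a?) (dec-false a? ¬a)

side : ℕ → ℤ
side zero    = + 1
side (suc j) = + 2 * side j

sgn : ℕ → ℤ
sgn zero    = + 1
sgn (suc j) = - sgn j

side-pos : ∀ j → + 0 < side j
side-pos zero    = +<+ (s≤s z≤n)
side-pos (suc j) = ℤ.*-monoˡ-<-pos (+ 2) (side-pos j)

sgn≡±1 : ∀ j → sgn j ≡ + 1 ⊎ sgn j ≡ - + 1
sgn≡±1 zero = inj₁ refl
sgn≡±1 (suc j) with sgn≡±1 j
... | inj₁ σ≡1  = inj₂ (cong -_ σ≡1)
... | inj₂ σ≡-1 = inj₁ (cong -_ σ≡-1)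

sgn*sgn≡1 : ∀ j → sgn j * sgn j ≡ + 1
sgn*sgn≡1 j with sgn≡±1 j
... | inj₁ σ≡1  rewrite σ≡1  = refl
... | inj₂ σ≡-1 rewrite σ≡-1 = refl

3*sgn≢0 : ∀ j → + 3 * sgn j ≢ + 0
3*sgn≢0 j with sgn≡±1 j
... | inj₁ σ≡1  rewrite σ≡1  = λ ()
... | inj₂ σ≡-1 rewrite σ≡-1 = λ ()

sgn²-factor : ∀ j y → sgn j * sgn j * y ≡ y
sgn²-factor j y rewrite sgn*sgn≡1 j = ℤ.*-identityˡ y

pow≡sgn*side : ∀ j → pow j ≡ sgn j * side j
pow≡sgn*side zero    = refl
pow≡sgn*side (suc j) = trans (cong (- + 2 *_) (pow≡sgn*side j)) (regroup (sgn j) (side j))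
  where
  regroup : ∀ σ m → - + 2 * (σ * m) ≡ - σ * (+ 2 * m)
  regroup = solve-∀

mid : ℕ → ℤ
mid j = + 2 * side j

-- The point u with u_i = (-2)^(j+1) + 3 (-1)^j x_i, so that (-2)^(j+1) T₀ is
-- { x_i ≥ 0 , x₁ + x₂ + x₃ = 2^(j+1) } and its midsegments are x_i = 2^j; both
-- sides are doubled, as in Defs.
toPlaneCoord : ℕ → ℤ → ℤ
toPlaneCoord j x = + 3 * sgn j * x - + 4 * pow j

toPlane : ℕ → Pt → Pt
toPlane j (pt a b c) = pt (toPlaneCoord j a) (toPlaneCoord j b) (toPlaneCoord j c)

onMidsegment : ∀ j x → ⌊ toPlaneCoord j x ≟ + 2 * pow j ⌋ ≡ ⌊ x ≟ mid j ⌋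
onMidsegment j x rewrite pow≡sgn*side j =
  isYes-⇔ (≡⇔≡-by-multiple (+ 3 * sgn j) (3*sgn≢0 j) (identity (sgn j) (side j) x)) _ _
  where
  identity : ∀ σ m x → + 2 * (σ * m) - (+ 3 * σ * x - + 4 * (σ * m)) ≡ + 3 * σ * (+ 2 * m - x)
  identity = solve-∀

inCorner-toPlaneCoord : ∀ j x → inCorner (pow j) (toPlaneCoord j x) ≡ ⌊ mid j <? x ⌋
inCorner-toPlaneCoord j x rewrite pow≡sgn*side j =
  isYes-⇔ (<⇔<-by-multiple (+ 3 * side j) (ℤ.*-monoˡ-<-pos (+ 3) (side-pos j))
             (trans (identity (sgn j) (side j) x) (sgn²-factor j _))) _ _
  where
  identity : ∀ σ m x → (σ * m) * (+ 3 * σ * x - + 4 * (σ * m)) - + 2 * ((σ * m) * (σ * m))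
                       ≡ σ * σ * (+ 3 * m * (x - + 2 * m))
  identity = solve-∀

pt-cong : ∀ {a b c a′ b′ c′} → a ≡ a′ → b ≡ b′ → c ≡ c′ → pt a b c ≡ pt a′ b′ c′
pt-cong refl refl refl = refl

-- Folding in (doubled) barycentric coordinates: a corner is reflected in its
-- midsegment and the central triangle is turned by a half-turn.  The reflected
-- coordinates + 2 * mid j - a - b are just c etc., as a + b + c = 2 * mid j at
-- every edge midpoint; they are written so only to match the reflection in Defs.
runBary : Seq → ℕ → Pt → Bool → Maybe Color
runBary S zero    _          o = nothing
runBary S (suc j) (pt a b c) o =
  if ⌊ a ≟ mid j ⌋ ∨ ⌊ b ≟ mid j ⌋ ∨ ⌊ c ≟ mid j ⌋ then just (creaseColor (S j) o)
  else if ⌊ mid j <? a ⌋ then runBary S j (pt (a - mid j) (+ 2 * mid j - a - b) (+ 2 * mid j - a - c)) (not o)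
  else if ⌊ mid j <? b ⌋ then runBary S j (pt (+ 2 * mid j - a - b) (b - mid j) (+ 2 * mid j - b - c)) (not o)
  else if ⌊ mid j <? c ⌋ then runBary S j (pt (+ 2 * mid j - a - c) (+ 2 * mid j - b - c) (c - mid j)) (not o)
  else runBary S j (pt (mid j - a) (mid j - b) (mid j - c)) o

reflected-coord : ∀ σ m {p} → p ≡ σ * m → ∀ x →
  + 4 * (- + 2 * p) - (+ 3 * - σ * x - + 4 * (- + 2 * p)) ≡ + 3 * σ * (x - + 2 * (+ 2 * m)) - + 4 * p
reflected-coord σ m refl x = solve (σ ∷ m ∷ x ∷ [])

carried-coord : ∀ σ m {p} → p ≡ σ * m → ∀ x y →
  (+ 3 * - σ * y - + 4 * (- + 2 * p)) + (+ 3 * - σ * x - + 4 * (- + 2 * p)) - + 2 * (- + 2 * p)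
    ≡ + 3 * σ * (+ 2 * (+ 2 * (+ 2 * m)) - x - y) - + 4 * p
carried-coord σ m refl x y = solve (σ ∷ m ∷ x ∷ y ∷ [])

carried-coord′ : ∀ σ m {p} → p ≡ σ * m → ∀ x y →
  (+ 3 * - σ * x - + 4 * (- + 2 * p)) + (+ 3 * - σ * y - + 4 * (- + 2 * p)) - + 2 * (- + 2 * p)
    ≡ + 3 * σ * (+ 2 * (+ 2 * (+ 2 * m)) - x - y) - + 4 * p
carried-coord′ σ m refl x y = solve (σ ∷ m ∷ x ∷ y ∷ [])

turned-coord : ∀ σ m {p} → p ≡ σ * m → ∀ x →
  + 3 * - σ * x - + 4 * (- + 2 * p) ≡ + 3 * σ * (+ 2 * (+ 2 * m) - x) - + 4 * p
turned-coord σ m refl x = solve (σ ∷ m ∷ x ∷ [])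

module FoldStep (j : ℕ) where

  reflected : ∀ x → + 4 * pow (suc j) - toPlaneCoord (suc j) x ≡ toPlaneCoord j (x - mid (suc j))
  reflected = reflected-coord (sgn j) (side j) (pow≡sgn*side j)

  carried : ∀ x y → toPlaneCoord (suc j) y + toPlaneCoord (suc j) x - + 2 * pow (suc j)
                    ≡ toPlaneCoord j (+ 2 * mid (suc j) - x - y)
  carried = carried-coord (sgn j) (side j) (pow≡sgn*side j)

  carried′ : ∀ x y → toPlaneCoord (suc j) x + toPlaneCoord (suc j) y - + 2 * pow (suc j)
                     ≡ toPlaneCoord j (+ 2 * mid (suc j) - x - y)
  carried′ = carried-coord′ (sgn j) (side j) (pow≡sgn*side j)

  turned : ∀ x → toPlaneCoord (suc j) x ≡ toPlaneCoord j (mid (suc j) - x)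
  turned = turned-coord (sgn j) (side j) (pow≡sgn*side j)

-- At level 0 both runs stop, so there is nothing to relate.
Represents : ℕ → Pt → Pt → Set
Represents zero    _ _ = ⊤
Represents (suc j) P D = P ≡ toPlane j D

corner₁-represented : ∀ j a b c →
  Represents j (pt (+ 4 * pow j - toPlaneCoord j a) (toPlaneCoord j b + toPlaneCoord j a - + 2 * pow j)
                   (toPlaneCoord j c + toPlaneCoord j a - + 2 * pow j))
               (pt (a - mid j) (+ 2 * mid j - a - b) (+ 2 * mid j - a - c))
corner₁-represented zero    a b c = tt
corner₁-represented (suc j) a b c = pt-cong (reflected a) (carried a b) (carried a c)
  where open FoldStep j

corner₂-represented : ∀ j a b c →
  Represents j (pt (toPlaneCoord j a + toPlaneCoord j b - + 2 * pow j) (+ 4 * pow j - toPlaneCoord j b)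
                   (toPlaneCoord j c + toPlaneCoord j b - + 2 * pow j))
               (pt (+ 2 * mid j - a - b) (b - mid j) (+ 2 * mid j - b - c))
corner₂-represented zero    a b c = tt
corner₂-represented (suc j) a b c = pt-cong (carried′ a b) (reflected b) (carried b c)
  where open FoldStep j

corner₃-represented : ∀ j a b c →
  Represents j (pt (toPlaneCoord j a + toPlaneCoord j c - + 2 * pow j) (toPlaneCoord j b + toPlaneCoord j c - + 2 * pow j)
                   (+ 4 * pow j - toPlaneCoord j c))
               (pt (+ 2 * mid j - a - c) (+ 2 * mid j - b - c) (c - mid j))
corner₃-represented zero    a b c = tt
corner₃-represented (suc j) a b c = pt-cong (carried′ a c) (carried′ b c) (reflected c)
  where open FoldStep j

centre-represented : ∀ j a b c →
  Represents j (pt (toPlaneCoord j a) (toPlaneCoord j b) (toPlaneCoord j c)) (pt (mid j - a) (mid j - b) (mid j - c))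
centre-represented zero    a b c = tt
centre-represented (suc j) a b c = pt-cong (turned a) (turned b) (turned c)
  where open FoldStep j

xor-true : ∀ o → o xor true ≡ not o
xor-true o = trans (xor-comm o true) (true-xor o)

mutual
  run-toPlane : ∀ S j D o → run S (suc j) (toPlane j D) o ≡ runBary S (suc j) D o
  run-toPlane S j (pt a b c) o
    rewrite onMidsegment j a | onMidsegment j b | onMidsegment j c
    with ⌊ a ≟ mid j ⌋ ∨ ⌊ b ≟ mid j ⌋ ∨ ⌊ c ≟ mid j ⌋
  ... | true = refl
  ... | false
    rewrite inCorner-toPlaneCoord j a | inCorner-toPlaneCoord j b | inCorner-toPlaneCoord j c
    with ⌊ mid j <? a ⌋ | ⌊ mid j <? b ⌋ | ⌊ mid j <? c ⌋
  ... | true  | _     | _     = run-represented S j (xor-true o) (corner₁-represented j a b c)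
  ... | false | true  | _     = run-represented S j (xor-true o) (corner₂-represented j a b c)
  ... | false | false | true  = run-represented S j (xor-true o) (corner₃-represented j a b c)
  ... | false | false | false = run-represented S j (xor-identityʳ o) (centre-represented j a b c)

  run-represented : ∀ S j {P D o o′} → o ≡ o′ → Represents j P D → run S j P o ≡ runBary S j D o′
  run-represented S zero    _    _    = refl
  run-represented S (suc j) refl refl = run-toPlane S j _ _

creaseColor-not : ∀ a o → creaseColor a (not o) ≡ flip (creaseColor a o)
creaseColor-not up   true  = refl
creaseColor-not up   false = refl
creaseColor-not down true  = refl
creaseColor-not down false = refl

runBary-not : ∀ S j D o → runBary S j D (not o) ≡ Maybe.map flip (runBary S j D o)
runBary-not S zero    D          o = refl
runBary-not S (suc j) (pt a b c) o with ⌊ a ≟ mid j ⌋ ∨ ⌊ b ≟ mid j ⌋ ∨ ⌊ c ≟ mid j ⌋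
... | true = cong just (creaseColor-not (S j) o)
... | false with ⌊ mid j <? a ⌋ | ⌊ mid j <? b ⌋ | ⌊ mid j <? c ⌋
... | true  | _     | _     = runBary-not S j _ (not o)
... | false | true  | _     = runBary-not S j _ (not o)
... | false | false | true  = runBary-not S j _ (not o)
... | false | false | false = runBary-not S j _ o

crease-test : ∀ {a b c m} → a ≡ m ⊎ b ≡ m ⊎ c ≡ m → ⌊ a ≟ m ⌋ ∨ ⌊ b ≟ m ⌋ ∨ ⌊ c ≟ m ⌋ ≡ true
crease-test {a} {b} {c} {m} (inj₁ a≡m)        rewrite isYes-true (a ≟ m) a≡m = refl
crease-test {a} {b} {c} {m} (inj₂ (inj₁ b≡m)) rewrite isYes-true (b ≟ m) b≡m = ∨-zeroʳ _
crease-test {a} {b} {c} {m} (inj₂ (inj₂ c≡m)) rewrite isYes-true (c ≟ m) c≡m | ∨-zeroʳ ⌊ b ≟ m ⌋ = ∨-zeroʳ _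

≢-test : ∀ {a m} → a < m ⊎ m < a → ⌊ a ≟ m ⌋ ≡ false
≢-test {a} {m} (inj₁ a<m) = isYes-false (a ≟ m) (ℤ.<⇒≢ a<m)
≢-test {a} {m} (inj₂ m<a) = isYes-false (a ≟ m) (ℤ.<⇒≢ m<a ∘ sym)

<-test : ∀ {a m} → a < m → ⌊ m <? a ⌋ ≡ false
<-test {a} {m} a<m = isYes-false (m <? a) (ℤ.<-asym a<m)

sum-minus₁₂ : ∀ {a b c t} → a + b + c ≡ t → t - a - b ≡ c
sum-minus₁₂ {a} {b} {c} refl = solve (a ∷ b ∷ c ∷ [])

sum-minus₁₃ : ∀ {a b c t} → a + b + c ≡ t → t - a - c ≡ b
sum-minus₁₃ {a} {b} {c} refl = solve (a ∷ b ∷ c ∷ [])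

sum-minus₂₃ : ∀ {a b c t} → a + b + c ≡ t → t - b - c ≡ a
sum-minus₂₃ {a} {b} {c} refl = solve (a ∷ b ∷ c ∷ [])

module _ (S : Seq) (j : ℕ) {a b c : ℤ} (o : Bool) where

  runBary-crease : a ≡ mid j ⊎ b ≡ mid j ⊎ c ≡ mid j → runBary S (suc j) (pt a b c) o ≡ just (creaseColor (S j) o)
  runBary-crease h rewrite crease-test h = refl

  runBary-centre : a < mid j → b < mid j → c < mid j →
    runBary S (suc j) (pt a b c) o ≡ runBary S j (pt (mid j - a) (mid j - b) (mid j - c)) o
  runBary-centre a< b< c<
    rewrite ≢-test (inj₁ a<) | ≢-test (inj₁ b<) | ≢-test (inj₁ c<) | <-test a< | <-test b< | <-test c< = refl

  runBary-corner₁ : a + b + c ≡ + 2 * mid j → mid j < a → b < mid j → c < mid j →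
    runBary S (suc j) (pt a b c) o ≡ runBary S j (pt (a - mid j) c b) (not o)
  runBary-corner₁ sum <a b< c<
    rewrite ≢-test (inj₂ <a) | ≢-test (inj₁ b<) | ≢-test (inj₁ c<) | isYes-true (mid j <? a) <a
    = cong (λ q → runBary S j q (not o)) (pt-cong refl (sum-minus₁₂ sum) (sum-minus₁₃ sum))

  runBary-corner₂ : a + b + c ≡ + 2 * mid j → a < mid j → mid j < b → c < mid j →
    runBary S (suc j) (pt a b c) o ≡ runBary S j (pt c (b - mid j) a) (not o)
  runBary-corner₂ sum a< <b c<
    rewrite ≢-test (inj₁ a<) | ≢-test (inj₂ <b) | ≢-test (inj₁ c<) | <-test a< | isYes-true (mid j <? b) <b
    = cong (λ q → runBary S j q (not o)) (pt-cong (sum-minus₁₂ sum) refl (sum-minus₂₃ sum))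

  runBary-corner₃ : a + b + c ≡ + 2 * mid j → a < mid j → b < mid j → mid j < c →
    runBary S (suc j) (pt a b c) o ≡ runBary S j (pt b a (c - mid j)) (not o)
  runBary-corner₃ sum a< b< <c
    rewrite ≢-test (inj₁ a<) | ≢-test (inj₁ b<) | ≢-test (inj₂ <c) | <-test a< | <-test b< | isYes-true (mid j <? c) <c
    = cong (λ q → runBary S j q (not o)) (pt-cong (sum-minus₁₃ sum) (sum-minus₂₃ sum) refl)

Fin6-elim : ∀ {P : Fin 6 → Set} → P 0F → P 1F → P 2F → P 3F → P 4F → P 5F → ∀ s → P s
Fin6-elim p₀ p₁ p₂ p₃ p₄ p₅ 0F = p₀
Fin6-elim p₀ p₁ p₂ p₃ p₄ p₅ 1F = p₁
Fin6-elim p₀ p₁ p₂ p₃ p₄ p₅ 2F = p₂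
Fin6-elim p₀ p₁ p₂ p₃ p₄ p₅ 3F = p₃
Fin6-elim p₀ p₁ p₂ p₃ p₄ p₅ 4F = p₄
Fin6-elim p₀ p₁ p₂ p₃ p₄ p₅ 5F = p₅

scale : ℤ → Pt → Pt
scale k (pt a b c) = pt (k * a) (k * b) (k * c)

δ : Fin 6 → Pt
δ 0F = pt (+ 0)   (+ 1)   (- + 1)
δ 1F = pt (- + 1) (+ 1)   (+ 0)
δ 2F = pt (- + 1) (+ 0)   (+ 1)
δ 3F = pt (+ 0)   (- + 1) (+ 1)
δ 4F = pt (+ 1)   (- + 1) (+ 0)
δ 5F = pt (+ 1)   (+ 0)   (- + 1)

dir≡3δ : ∀ s → dir s ≡ scale (+ 3) (δ s)
dir≡3δ = Fin6-elim refl refl refl refl refl refl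

δ-sum : ∀ s → p₁ (δ s) + p₂ (δ s) + p₃ (δ s) ≡ + 0
δ-sum = Fin6-elim refl refl refl refl refl refl

δ≤1 : ∀ s → p₁ (δ s) ≤ + 1 × p₂ (δ s) ≤ + 1 × p₃ (δ s) ≤ + 1
δ≤1 = from-yes (all? λ s → (p₁ (δ s) ℤ.≤? + 1) ×-dec ((p₂ (δ s) ℤ.≤? + 1) ×-dec (p₃ (δ s) ℤ.≤? + 1)))

-1≤δ : ∀ s → - + 1 ≤ p₁ (δ s) × - + 1 ≤ p₂ (δ s) × - + 1 ≤ p₃ (δ s)
-1≤δ = from-yes (all? λ s → (- + 1 ℤ.≤? p₁ (δ s)) ×-dec ((- + 1 ℤ.≤? p₂ (δ s)) ×-dec (- + 1 ℤ.≤? p₃ (δ s))))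

regroup-edge : ∀ x y z d₁ d₂ d₃ → (+ 2 * x + d₁) + (+ 2 * y + d₂) + (+ 2 * z + d₃) ≡ + 2 * (x + y + z) + (d₁ + d₂ + d₃)
regroup-edge = solve-∀

edgeB : Pt → Fin 6 → Pt
edgeB (pt x y z) s = pt (+ 2 * x + p₁ (δ s)) (+ 2 * y + p₂ (δ s)) (+ 2 * z + p₃ (δ s))

edgeB-sum : ∀ {x y z t} s → x + y + z ≡ t → let e = edgeB (pt x y z) s in p₁ e + p₂ e + p₃ e ≡ + 2 * t
edgeB-sum {x} {y} {z} s refl = trans (regroup-edge x y z (p₁ (δ s)) (p₂ (δ s)) (p₃ (δ s)))
                                     (trans (cong (λ d → + 2 * (x + y + z) + d) (δ-sum s)) (ℤ.+-identityʳ _))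

third : Fin 6 → Fin 6
third s = next (next s)

halfTurn : Fin 6 → Fin 6
halfTurn s = next (next (next s))

mirror₁ : Fin 6 → Fin 6
mirror₁ 0F = 3F
mirror₁ 1F = 2F
mirror₁ 2F = 1F
mirror₁ 3F = 0F
mirror₁ 4F = 5F
mirror₁ 5F = 4F

mirror₂ : Fin 6 → Fin 6
mirror₂ 0F = 1F
mirror₂ 1F = 0F
mirror₂ 2F = 5F
mirror₂ 3F = 4F
mirror₂ 4F = 3F
mirror₂ 5F = 2F

mirror₃ : Fin 6 → Fin 6
mirror₃ 0F = 5F
mirror₃ 1F = 4F
mirror₃ 2F = 3F
mirror₃ 3F = 2F
mirror₃ 4F = 1F
mirror₃ 5F = 0F

δ-halfTurn : ∀ s → δ (halfTurn s) ≡ scale (- + 1) (δ s)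
δ-halfTurn = Fin6-elim refl refl refl refl refl refl

δ-mirror₁ : ∀ s → δ (mirror₁ s) ≡ pt (p₁ (δ s)) (p₃ (δ s)) (p₂ (δ s))
δ-mirror₁ = Fin6-elim refl refl refl refl refl refl

δ-mirror₂ : ∀ s → δ (mirror₂ s) ≡ pt (p₃ (δ s)) (p₂ (δ s)) (p₁ (δ s))
δ-mirror₂ = Fin6-elim refl refl refl refl refl refl

δ-mirror₃ : ∀ s → δ (mirror₃ s) ≡ pt (p₂ (δ s)) (p₁ (δ s)) (p₃ (δ s))
δ-mirror₃ = Fin6-elim refl refl refl refl refl refl

inPair : Fin 6 → Fin 6 → Bool
inPair r s = ⌊ s Fin.≟ r ⌋ ∨ ⌊ s Fin.≟ next r ⌋

pairColour : Fin 6 → Color → Fin 6 → Color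
pairColour r c s = if inPair r s then c else flip c

record PairColoured (f : Fin 6 → Maybe Color) : Set where
  constructor pairColoured
  field
    start   : Fin 6
    colour  : Color
    colours : ∀ s → f s ≡ just (pairColour start colour s)

PairColoured-reindex : ∀ {f g} (τ τ* : Fin 6 → Fin 6) → (∀ r s → inPair (τ* r) s ≡ inPair r (τ s)) →
  (∀ s → f s ≡ g (τ s)) → PairColoured g → PairColoured f
PairColoured-reindex τ τ* pairs f≡g∘τ (pairColoured r c g≡) =
  pairColoured (τ* r) c λ s → trans (f≡g∘τ s) (trans (g≡ (τ s)) (cong (λ b → just (if b then c else flip c)) (sym (pairs r s))))

inPair-halfTurn : ∀ r s → inPair (halfTurn r) s ≡ inPair r (halfTurn s)
inPair-halfTurn = from-yes (all? λ r → all? λ s → inPair (halfTurn r) s Bool.≟ inPair r (halfTurn s))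

inPair-mirror₁ : ∀ r s → inPair (mirror₁ (next r)) s ≡ inPair r (mirror₁ s)
inPair-mirror₁ = from-yes (all? λ r → all? λ s → inPair (mirror₁ (next r)) s Bool.≟ inPair r (mirror₁ s))

inPair-mirror₂ : ∀ r s → inPair (mirror₂ (next r)) s ≡ inPair r (mirror₂ s)
inPair-mirror₂ = from-yes (all? λ r → all? λ s → inPair (mirror₂ (next r)) s Bool.≟ inPair r (mirror₂ s))

inPair-mirror₃ : ∀ r s → inPair (mirror₃ (next r)) s ≡ inPair r (mirror₃ s)
inPair-mirror₃ = from-yes (all? λ r → all? λ s → inPair (mirror₃ (next r)) s Bool.≟ inPair r (mirror₃ s))

inPair-third : ∀ r s → inPair (third r) s ≡ inPair r (third (third s))
inPair-third = from-yes (all? λ r → all? λ s → inPair (third r) s Bool.≟ inPair r (third (third s)))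

PairColoured-halfTurn : ∀ {f g} → (∀ s → f s ≡ g (halfTurn s)) → PairColoured g → PairColoured f
PairColoured-halfTurn = PairColoured-reindex halfTurn halfTurn inPair-halfTurn

PairColoured-mirror₁ : ∀ {f g} → (∀ s → f s ≡ g (mirror₁ s)) → PairColoured g → PairColoured f
PairColoured-mirror₁ = PairColoured-reindex mirror₁ (mirror₁ ∘ next) inPair-mirror₁

PairColoured-mirror₂ : ∀ {f g} → (∀ s → f s ≡ g (mirror₂ s)) → PairColoured g → PairColoured f
PairColoured-mirror₂ = PairColoured-reindex mirror₂ (mirror₂ ∘ next) inPair-mirror₂

PairColoured-mirror₃ : ∀ {f g} → (∀ s → f s ≡ g (mirror₃ s)) → PairColoured g → PairColoured f
PairColoured-mirror₃ = PairColoured-reindex mirror₃ (mirror₃ ∘ next) inPair-mirror₃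

PairColoured-third : ∀ {f g} → (∀ s → f s ≡ g (third (third s))) → PairColoured g → PairColoured f
PairColoured-third = PairColoured-reindex (λ s → third (third s)) third inPair-third

-- The colours around a vertex on the midsegment x₁ = 2^j.
PairColoured-crease : ∀ {f} c d → f 0F ≡ just d → f 3F ≡ just d → f 1F ≡ just c → f 2F ≡ just c →
  f 4F ≡ just (flip c) → f 5F ≡ just (flip c) → PairColoured f
PairColoured-crease red  red  h₀ h₃ h₁ h₂ h₄ h₅ = pairColoured 4F blue (Fin6-elim h₀ h₁ h₂ h₃ h₄ h₅)
PairColoured-crease blue blue h₀ h₃ h₁ h₂ h₄ h₅ = pairColoured 4F red  (Fin6-elim h₀ h₁ h₂ h₃ h₄ h₅)
PairColoured-crease red  blue h₀ h₃ h₁ h₂ h₄ h₅ = pairColoured 1F red  (Fin6-elim h₀ h₁ h₂ h₃ h₄ h₅)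
PairColoured-crease blue red  h₀ h₃ h₁ h₂ h₄ h₅ = pairColoured 1F blue (Fin6-elim h₀ h₁ h₂ h₃ h₄ h₅)

2x+d<2m : ∀ {x m d} → x < m → d ≤ + 1 → + 2 * x + d < + 2 * m
2x+d<2m {x} {m} {d} x<m d≤1 =
  0≤gap⇒< (subst (+ 0 ≤_) (gaps x m d) (0≤-+ (0≤-+ (<⇒0≤gap x<m) (<⇒0≤gap x<m)) (ℤ.i≤j⇒0≤j-i d≤1)))
  where
  gaps : ∀ x m d → (m - (+ 1 + x)) + (m - (+ 1 + x)) + (+ 1 - d) ≡ + 2 * m - (+ 1 + (+ 2 * x + d))
  gaps = solve-∀

2m<2x+d : ∀ {x m d} → m < x → - + 1 ≤ d → + 2 * m < + 2 * x + d
2m<2x+d {x} {m} {d} m<x -1≤d =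
  0≤gap⇒< (subst (+ 0 ≤_) (gaps x m d) (0≤-+ (0≤-+ (<⇒0≤gap m<x) (<⇒0≤gap m<x)) (ℤ.i≤j⇒0≤j-i -1≤d)))
  where
  gaps : ∀ x m d → (x - (+ 1 + m)) + (x - (+ 1 + m)) + (d - - + 1) ≡ + 2 * x + d - (+ 1 + + 2 * m)
  gaps = solve-∀

module _ (s : Fin 6) {v m : ℤ} where

  below₁ : v < m → + 2 * v + p₁ (δ s) < + 2 * m
  below₁ h = 2x+d<2m h (proj₁ (δ≤1 s))

  below₂ : v < m → + 2 * v + p₂ (δ s) < + 2 * m
  below₂ h = 2x+d<2m h (proj₁ (proj₂ (δ≤1 s)))

  below₃ : v < m → + 2 * v + p₃ (δ s) < + 2 * m
  below₃ h = 2x+d<2m h (proj₂ (proj₂ (δ≤1 s)))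

  above₁ : m < v → + 2 * m < + 2 * v + p₁ (δ s)
  above₁ h = 2m<2x+d h (proj₁ (-1≤δ s))

  above₂ : m < v → + 2 * m < + 2 * v + p₂ (δ s)
  above₂ h = 2m<2x+d h (proj₁ (proj₂ (-1≤δ s)))

  above₃ : m < v → + 2 * m < + 2 * v + p₃ (δ s)
  above₃ h = 2m<2x+d h (proj₂ (proj₂ (-1≤δ s)))

on-line : ∀ {x m} → x ≡ m → + 2 * x + + 0 ≡ + 2 * m
on-line {x} refl = ℤ.+-identityʳ (+ 2 * x)

below-line : ∀ {x m} → x ≡ m → + 2 * x + - + 1 < + 2 * m
below-line {x} refl = 0≤gap⇒< (ℤ.≤-reflexive (sym (gap x)))
  where
  gap : ∀ x → + 2 * x - (+ 1 + (+ 2 * x + - + 1)) ≡ + 0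
  gap = solve-∀

above-line : ∀ {x m} → x ≡ m → + 2 * m < + 2 * x + + 1
above-line {x} refl = 0≤gap⇒< (ℤ.≤-reflexive (sym (gap x)))
  where
  gap : ∀ x → + 2 * x + + 1 - (+ 1 + + 2 * x) ≡ + 0
  gap = solve-∀

colours : Seq → ℕ → Bool → Pt → Fin 6 → Maybe Color
colours S n o p s = runBary S n (edgeB p s) o

turned-edge : ∀ m x y z s → pt (+ 2 * m - p₁ (edgeB (pt x y z) s)) (+ 2 * m - p₂ (edgeB (pt x y z) s)) (+ 2 * m - p₃ (edgeB (pt x y z) s))
                            ≡ edgeB (pt (m - x) (m - y) (m - z)) (halfTurn s)
turned-edge m x y z s rewrite δ-halfTurn s = pt-cong (turn m x (p₁ (δ s))) (turn m y (p₂ (δ s))) (turn m z (p₃ (δ s)))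
  where
  turn : ∀ m x d → + 2 * m - (+ 2 * x + d) ≡ + 2 * (m - x) + - + 1 * d
  turn = solve-∀

shifted : ∀ m x d → + 2 * x + d - + 2 * m ≡ + 2 * (x - m) + d
shifted = solve-∀

module _ (S : Seq) (j : ℕ) (o : Bool) {x y z : ℤ} (s : Fin 6) where
  private
    e = edgeB (pt x y z) s
    m = side j
    step : ∀ {D D′ o′} → D ≡ D′ → runBary S j D o′ ≡ runBary S j D′ o′
    step {o′ = o′} = cong (λ D → runBary S j D o′)

  edge-crease : p₁ e ≡ mid j ⊎ p₂ e ≡ mid j ⊎ p₃ e ≡ mid j → colours S (suc j) o (pt x y z) s ≡ just (creaseColor (S j) o)
  edge-crease = runBary-crease S j o

  edge-centre : p₁ e < mid j → p₂ e < mid j → p₃ e < mid j →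
    colours S (suc j) o (pt x y z) s ≡ colours S j o (pt (m - x) (m - y) (m - z)) (halfTurn s)
  edge-centre h₁ h₂ h₃ = trans (runBary-centre S j o h₁ h₂ h₃) (step (turned-edge m x y z s))

  edge-corner₁ : x + y + z ≡ mid j → mid j < p₁ e → p₂ e < mid j → p₃ e < mid j →
    colours S (suc j) o (pt x y z) s ≡ colours S j (not o) (pt (x - m) z y) (mirror₁ s)
  edge-corner₁ sum h₁ h₂ h₃ rewrite δ-mirror₁ s =
    trans (runBary-corner₁ S j o (edgeB-sum {x} {y} {z} s sum) h₁ h₂ h₃) (step (pt-cong (shifted m x (p₁ (δ s))) refl refl))

  edge-corner₂ : x + y + z ≡ mid j → p₁ e < mid j → mid j < p₂ e → p₃ e < mid j →
    colours S (suc j) o (pt x y z) s ≡ colours S j (not o) (pt z (y - m) x) (mirror₂ s)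
  edge-corner₂ sum h₁ h₂ h₃ rewrite δ-mirror₂ s =
    trans (runBary-corner₂ S j o (edgeB-sum {x} {y} {z} s sum) h₁ h₂ h₃) (step (pt-cong refl (shifted m y (p₂ (δ s))) refl))

  edge-corner₃ : x + y + z ≡ mid j → p₁ e < mid j → p₂ e < mid j → mid j < p₃ e →
    colours S (suc j) o (pt x y z) s ≡ colours S j (not o) (pt y x (z - m)) (mirror₃ s)
  edge-corner₃ sum h₁ h₂ h₃ rewrite δ-mirror₃ s =
    trans (runBary-corner₃ S j o (edgeB-sum {x} {y} {z} s sum) h₁ h₂ h₃) (step (pt-cong refl refl (shifted m z (p₃ (δ s)))))

sum-xzy : ∀ {x y z t} → x + y + z ≡ t → x + z + y ≡ t
sum-xzy {x} {y} {z} refl = solve (x ∷ y ∷ z ∷ [])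

sum-yxz : ∀ {x y z t} → x + y + z ≡ t → y + x + z ≡ t
sum-yxz {x} {y} {z} refl = solve (x ∷ y ∷ z ∷ [])

sum-yzx : ∀ {x y z t} → x + y + z ≡ t → y + z + x ≡ t
sum-yzx {x} {y} {z} refl = solve (x ∷ y ∷ z ∷ [])

sum-zxy : ∀ {x y z t} → x + y + z ≡ t → z + x + y ≡ t
sum-zxy {x} {y} {z} refl = solve (x ∷ y ∷ z ∷ [])

sum-zyx : ∀ {x y z t} → x + y + z ≡ t → z + y + x ≡ t
sum-zyx {x} {y} {z} refl = solve (x ∷ y ∷ z ∷ [])

<-by-sum : ∀ {a b c m} → a + b + c ≡ + 2 * m → m < a → + 0 ≤ c → b < m
<-by-sum {a} {b} {c} {m} sum m<a 0≤c =
  0≤gap⇒< (subst (+ 0 ≤_) (gaps a b c m) (0≤-+ (0≤-+ (<⇒0≤gap m<a) 0≤c) (≡⇒0≤- sum)))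
  where
  gaps : ∀ a b c m → (a - (+ 1 + m)) + c + (+ 2 * m - (a + b + c)) ≡ m - (+ 1 + b)
  gaps = solve-∀

<-by-sum′ : ∀ {a b c m} → a + b + c ≡ + 2 * m → a ≡ m → + 0 < c → b < m
<-by-sum′ {a} {b} {c} sum refl 0<c =
  0≤gap⇒< (subst (+ 0 ≤_) (gaps a b c) (0≤-+ (<⇒0≤gap 0<c) (≡⇒0≤- sum)))
  where
  gaps : ∀ a b c → (c - (+ 1 + + 0)) + (+ 2 * a - (a + b + c)) ≡ a - (+ 1 + b)
  gaps = solve-∀

>-by-sum : ∀ {a b c m} → a + b + c ≡ + 2 * m → a < m → c ≡ + 0 → m < b
>-by-sum {a} {b} {c} {m} sum a<m refl =
  0≤gap⇒< (subst (+ 0 ≤_) (gaps a b m) (0≤-+ (<⇒0≤gap a<m) (≡⇒0≤- (sym sum))))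
  where
  gaps : ∀ a b m → (m - (+ 1 + a)) + (a + b + + 0 - + 2 * m) ≡ b - (+ 1 + m)
  gaps = solve-∀

≡-by-sum : ∀ {a b c m} → a + b + c ≡ + 2 * m → a ≡ m → c ≡ + 0 → b ≡ m
≡-by-sum {a} {b} sum refl refl = trans (regroup a b) (trans (cong (_- a) sum) (twice-minus a))
  where
  regroup : ∀ a b → b ≡ a + b + + 0 - a
  regroup = solve-∀
  twice-minus : ∀ a → + 2 * a - a ≡ a
  twice-minus = solve-∀

0<i<1⇒⊥ : ∀ {a} → + 0 < a → a < + 1 → ⊥
0<i<1⇒⊥ 0<a a<1 = ℤ.<-irrefl refl (ℤ.<-≤-trans a<1 (ℤ.i<j⇒suc[i]≤j 0<a))

minus-half : ∀ {s m} → s ≡ + 2 * m → s - m ≡ m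
minus-half {m = m} refl = solve (m ∷ [])

corner₁-sum : ∀ {x y z m} → x + y + z ≡ + 2 * m → (x - m) + z + y ≡ m
corner₁-sum {x} {y} {z} {m} sum = trans (regroup x y z m) (minus-half sum)
  where
  regroup : ∀ x y z m → (x - m) + z + y ≡ x + y + z - m
  regroup = solve-∀

corner₂-sum : ∀ {x y z m} → x + y + z ≡ + 2 * m → z + (y - m) + x ≡ m
corner₂-sum {x} {y} {z} {m} sum = trans (regroup x y z m) (minus-half sum)
  where
  regroup : ∀ x y z m → z + (y - m) + x ≡ x + y + z - m
  regroup = solve-∀

corner₃-sum : ∀ {x y z m} → x + y + z ≡ + 2 * m → y + x + (z - m) ≡ m
corner₃-sum {x} {y} {z} {m} sum = trans (regroup x y z m) (minus-half sum)
  where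
  regroup : ∀ x y z m → y + x + (z - m) ≡ x + y + z - m
  regroup = solve-∀

centre-sum : ∀ {x y z m} → x + y + z ≡ + 2 * m → (m - x) + (m - y) + (m - z) ≡ m
centre-sum {x} {y} {z} {m} sum = trans (regroup x y z m) (trans (cong (λ s → + 3 * m - s) sum) (thrice-minus m))
  where
  regroup : ∀ x y z m → (m - x) + (m - y) + (m - z) ≡ + 3 * m - (x + y + z)
  regroup = solve-∀
  thrice-minus : ∀ m → + 3 * m - + 2 * m ≡ m
  thrice-minus = solve-∀

module _ (S : Seq) (j : ℕ) (o : Bool) {x y z : ℤ} where
  private
    m = side j

  vertex-centre : x < m → y < m → z < m →
    ∀ s → colours S (suc j) o (pt x y z) s ≡ colours S j o (pt (m - x) (m - y) (m - z)) (halfTurn s)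
  vertex-centre x< y< z< s = edge-centre S j o {x} {y} {z} s (below₁ s x<) (below₂ s y<) (below₃ s z<)

  vertex-corner₁ : x + y + z ≡ mid j → m < x → + 0 ≤ y → + 0 ≤ z →
    ∀ s → colours S (suc j) o (pt x y z) s ≡ colours S j (not o) (pt (x - m) z y) (mirror₁ s)
  vertex-corner₁ sum <x 0≤y 0≤z s = edge-corner₁ S j o {x} {y} {z} s sum (above₁ s <x)
    (below₂ s (<-by-sum sum <x 0≤z)) (below₃ s (<-by-sum (sum-xzy {x} {y} {z} sum) <x 0≤y))

  vertex-corner₂ : x + y + z ≡ mid j → m < y → + 0 ≤ x → + 0 ≤ z →
    ∀ s → colours S (suc j) o (pt x y z) s ≡ colours S j (not o) (pt z (y - m) x) (mirror₂ s)
  vertex-corner₂ sum <y 0≤x 0≤z s = edge-corner₂ S j o {x} {y} {z} s sum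
    (below₁ s (<-by-sum (sum-yxz {x} {y} {z} sum) <y 0≤z)) (above₂ s <y) (below₃ s (<-by-sum (sum-yzx {x} {y} {z} sum) <y 0≤x))

  vertex-corner₃ : x + y + z ≡ mid j → m < z → + 0 ≤ x → + 0 ≤ y →
    ∀ s → colours S (suc j) o (pt x y z) s ≡ colours S j (not o) (pt y x (z - m)) (mirror₃ s)
  vertex-corner₃ sum <z 0≤x 0≤y s = edge-corner₃ S j o {x} {y} {z} s sum
    (below₁ s (<-by-sum (sum-zxy {x} {y} {z} sum) <z 0≤y)) (below₂ s (<-by-sum (sum-zyx {x} {y} {z} sum) <z 0≤x)) (above₃ s <z)

record SameColour (f : Fin 6 → Maybe Color) (s t : Fin 6) : Set where
  constructor sameColour
  field
    colour : Color
    at₁    : f s ≡ just colour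
    at₂    : f t ≡ just colour

SameColour-reindex : ∀ {f g} (τ : Fin 6 → Fin 6) → (∀ s → f s ≡ g (τ s)) →
  ∀ {s t} → SameColour g (τ t) (τ s) → SameColour f s t
SameColour-reindex τ f≡g∘τ {s} {t} (sameColour c g-t g-s) = sameColour c (trans (f≡g∘τ s) g-s) (trans (f≡g∘τ t) g-t)

≡0⇒0≤ : ∀ {a} → a ≡ + 0 → + 0 ≤ a
≡0⇒0≤ a≡0 = ℤ.≤-reflexive (sym a≡0)

<⇒0<- : ∀ {a b} → a < b → + 0 < b - a
<⇒0<- = Equivalence.to <⇔0<-

-- 4F, 5F are the edges entering the triangle from its side x = 0; similarly 0F, 1F for y = 0
-- and 2F, 3F for z = 0.
mutual
  boundary₁ : ∀ S j o {x y z} → x + y + z ≡ mid j → x ≡ + 0 → + 0 < y → + 0 < z →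
    SameColour (colours S (suc j) o (pt x y z)) 4F 5F
  boundary₁ S j o {x} {y} {z} sum x≡0 0<y 0<z with ℤ.<-cmp y (side j)
  ... | tri≈ _ y≡m _ = sameColour (creaseColor (S j) o)
    (edge-crease S j o {x} {y} {z} 4F (inj₂ (inj₂ (on-line (≡-by-sum (sum-yzx {x} {y} {z} sum) y≡m x≡0)))))
    (edge-crease S j o {x} {y} {z} 5F (inj₂ (inj₁ (on-line y≡m))))
  boundary₁ S zero o {x} {y} {z} sum x≡0 0<y 0<z | tri> _ _ m<y =
    ⊥-elim (0<i<1⇒⊥ 0<z (<-by-sum (sum-yzx {x} {y} {z} sum) m<y (≡0⇒0≤ x≡0)))
  boundary₁ S (suc j) o {x} {y} {z} sum x≡0 0<y 0<z | tri> _ _ m<y =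
    SameColour-reindex mirror₂ (vertex-corner₂ S (suc j) o sum m<y (≡0⇒0≤ x≡0) (ℤ.<⇒≤ 0<z))
      (boundary₃ S j (not o) (corner₂-sum {x} {y} {z} sum) x≡0 0<z (<⇒0<- m<y))
  boundary₁ S zero o sum x≡0 0<y 0<z | tri< y<m _ _ = ⊥-elim (0<i<1⇒⊥ 0<y y<m)
  boundary₁ S (suc j) o {x} {y} {z} sum x≡0 0<y 0<z | tri< y<m _ _ =
    SameColour-reindex mirror₃ (vertex-corner₃ S (suc j) o sum m<z (≡0⇒0≤ x≡0) (ℤ.<⇒≤ 0<y))
      (boundary₂ S j (not o) (corner₃-sum {x} {y} {z} sum) x≡0 0<y (<⇒0<- m<z))
    where
    m<z = >-by-sum (sum-yzx {x} {y} {z} sum) y<m x≡0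

  boundary₂ : ∀ S j o {x y z} → x + y + z ≡ mid j → y ≡ + 0 → + 0 < x → + 0 < z →
    SameColour (colours S (suc j) o (pt x y z)) 0F 1F
  boundary₂ S j o {x} {y} {z} sum y≡0 0<x 0<z with ℤ.<-cmp x (side j)
  ... | tri≈ _ x≡m _ = sameColour (creaseColor (S j) o)
    (edge-crease S j o {x} {y} {z} 0F (inj₁ (on-line x≡m)))
    (edge-crease S j o {x} {y} {z} 1F (inj₂ (inj₂ (on-line (≡-by-sum (sum-xzy {x} {y} {z} sum) x≡m y≡0)))))
  boundary₂ S zero o {x} {y} {z} sum y≡0 0<x 0<z | tri> _ _ m<x =
    ⊥-elim (0<i<1⇒⊥ 0<z (<-by-sum (sum-xzy {x} {y} {z} sum) m<x (≡0⇒0≤ y≡0)))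
  boundary₂ S (suc j) o {x} {y} {z} sum y≡0 0<x 0<z | tri> _ _ m<x =
    SameColour-reindex mirror₁ (vertex-corner₁ S (suc j) o sum m<x (≡0⇒0≤ y≡0) (ℤ.<⇒≤ 0<z))
      (boundary₃ S j (not o) (corner₁-sum {x} {y} {z} sum) y≡0 (<⇒0<- m<x) 0<z)
  boundary₂ S zero o sum y≡0 0<x 0<z | tri< x<m _ _ = ⊥-elim (0<i<1⇒⊥ 0<x x<m)
  boundary₂ S (suc j) o {x} {y} {z} sum y≡0 0<x 0<z | tri< x<m _ _ =
    SameColour-reindex mirror₃ (vertex-corner₃ S (suc j) o sum m<z (ℤ.<⇒≤ 0<x) (≡0⇒0≤ y≡0))
      (boundary₁ S j (not o) (corner₃-sum {x} {y} {z} sum) y≡0 0<x (<⇒0<- m<z))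
    where
    m<z = >-by-sum (sum-xzy {x} {y} {z} sum) x<m y≡0

  boundary₃ : ∀ S j o {x y z} → x + y + z ≡ mid j → z ≡ + 0 → + 0 < x → + 0 < y →
    SameColour (colours S (suc j) o (pt x y z)) 2F 3F
  boundary₃ S j o {x} {y} {z} sum z≡0 0<x 0<y with ℤ.<-cmp x (side j)
  ... | tri≈ _ x≡m _ = sameColour (creaseColor (S j) o)
    (edge-crease S j o {x} {y} {z} 2F (inj₂ (inj₁ (on-line (≡-by-sum sum x≡m z≡0)))))
    (edge-crease S j o {x} {y} {z} 3F (inj₁ (on-line x≡m)))
  boundary₃ S zero o sum z≡0 0<x 0<y | tri> _ _ m<x = ⊥-elim (0<i<1⇒⊥ 0<y (<-by-sum sum m<x (≡0⇒0≤ z≡0)))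
  boundary₃ S (suc j) o {x} {y} {z} sum z≡0 0<x 0<y | tri> _ _ m<x =
    SameColour-reindex mirror₁ (vertex-corner₁ S (suc j) o sum m<x (ℤ.<⇒≤ 0<y) (≡0⇒0≤ z≡0))
      (boundary₂ S j (not o) (corner₁-sum {x} {y} {z} sum) z≡0 (<⇒0<- m<x) 0<y)
  boundary₃ S zero o sum z≡0 0<x 0<y | tri< x<m _ _ = ⊥-elim (0<i<1⇒⊥ 0<x x<m)
  boundary₃ S (suc j) o {x} {y} {z} sum z≡0 0<x 0<y | tri< x<m _ _ =
    SameColour-reindex mirror₂ (vertex-corner₂ S (suc j) o sum m<y (ℤ.<⇒≤ 0<x) (≡0⇒0≤ z≡0))
      (boundary₁ S j (not o) (corner₂-sum {x} {y} {z} sum) z≡0 (<⇒0<- m<y) 0<x)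
    where
    m<y = >-by-sum sum x<m z≡0

centre-coord : ∀ {a b c} → a + b + c ≡ + 2 * a → a - b ≡ c
centre-coord {a} {b} {c} sum = trans (regroup a b) (sum-minus₁₂ sum)
  where
  regroup : ∀ a b → a - b ≡ + 2 * a - a - b
  regroup = solve-∀

colours-flipped : ∀ S n o {p q c} s → p ≡ q → colours S n o q s ≡ just c → colours S n (not o) p s ≡ just (flip c)
colours-flipped S n o {q = q} s refl q-s = trans (runBary-not S n (edgeB q s) o) (cong (Maybe.map flip) q-s)

third³ : ∀ s → third (third (third s)) ≡ s
third³ = Fin6-elim refl refl refl refl refl refl

PairColoured-rotated : ∀ {f} → PairColoured (λ s → f (third s)) → PairColoured f
PairColoured-rotated {f} = PairColoured-third (λ s → cong f (sym (third³ s)))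

-- On the midsegment x = m the crease edges 0F, 3F get the crease colour;
-- the edges 1F, 2F into the central triangle and 4F, 5F into the corner are
-- carried to the same boundary vertex, the latter with reversed orientation.
crease₁ : ∀ S j o {x y z} → x + y + z ≡ mid (suc j) → x ≡ side (suc j) → + 0 < y → + 0 < z →
  PairColoured (colours S (suc (suc j)) o (pt x y z))
crease₁ S j o {y = y} {z} sum refl 0<y 0<z = PairColoured-crease c (creaseColor (S (suc j)) o)
  (edge-crease S (suc j) o {m} {y} {z} 0F (inj₁ (on-line refl)))
  (edge-crease S (suc j) o {m} {y} {z} 3F (inj₁ (on-line refl)))
  (trans (edge-centre S (suc j) o {m} {y} {z} 1F (below-line refl) (below₂ 1F y<m) (below₃ 1F z<m)) (SameColour.at₁ boundary))
  (trans (edge-centre S (suc j) o {m} {y} {z} 2F (below-line refl) (below₂ 2F y<m) (below₃ 2F z<m)) (SameColour.at₂ boundary))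
  (trans (edge-corner₁ S (suc j) o {m} {y} {z} 4F sum (above-line refl) (below₂ 4F y<m) (below₃ 4F z<m))
         (colours-flipped S (suc j) o 5F meet (SameColour.at₂ boundary)))
  (trans (edge-corner₁ S (suc j) o {m} {y} {z} 5F sum (above-line refl) (below₂ 5F y<m) (below₃ 5F z<m))
         (colours-flipped S (suc j) o 4F meet (SameColour.at₁ boundary)))
  where
  m = side (suc j)
  y<m = <-by-sum′ sum refl 0<z
  z<m = <-by-sum′ (sum-xzy {m} {y} {z} sum) refl 0<y
  boundary = boundary₁ S j o (centre-sum {m} {y} {z} sum) (ℤ.+-inverseʳ m) (<⇒0<- y<m) (<⇒0<- z<m)
  c = SameColour.colour boundary
  meet : pt (m - m) z y ≡ pt (m - m) (m - y) (m - z)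
  meet = pt-cong refl (sym (centre-coord sum)) (sym (centre-coord (sum-xzy {m} {y} {z} sum)))

crease₂ : ∀ S j o {x y z} → x + y + z ≡ mid (suc j) → y ≡ side (suc j) → + 0 < x → + 0 < z →
  PairColoured (colours S (suc (suc j)) o (pt x y z))
crease₂ S j o {x} {z = z} sum refl 0<x 0<z = PairColoured-rotated (PairColoured-crease c (creaseColor (S (suc j)) o)
  (edge-crease S (suc j) o {x} {m} {z} 2F (inj₂ (inj₁ (on-line refl))))
  (edge-crease S (suc j) o {x} {m} {z} 5F (inj₂ (inj₁ (on-line refl))))
  (trans (edge-centre S (suc j) o {x} {m} {z} 3F (below₁ 3F x<m) (below-line refl) (below₃ 3F z<m)) (SameColour.at₁ boundary))
  (trans (edge-centre S (suc j) o {x} {m} {z} 4F (below₁ 4F x<m) (below-line refl) (below₃ 4F z<m)) (SameColour.at₂ boundary))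
  (trans (edge-corner₂ S (suc j) o {x} {m} {z} 0F sum (below₁ 0F x<m) (above-line refl) (below₃ 0F z<m))
         (colours-flipped S (suc j) o 1F meet (SameColour.at₂ boundary)))
  (trans (edge-corner₂ S (suc j) o {x} {m} {z} 1F sum (below₁ 1F x<m) (above-line refl) (below₃ 1F z<m))
         (colours-flipped S (suc j) o 0F meet (SameColour.at₁ boundary))))
  where
  m = side (suc j)
  x<m = <-by-sum′ (sum-yxz {x} {m} {z} sum) refl 0<z
  z<m = <-by-sum′ (sum-yzx {x} {m} {z} sum) refl 0<x
  boundary = boundary₂ S j o (centre-sum {x} {m} {z} sum) (ℤ.+-inverseʳ m) (<⇒0<- x<m) (<⇒0<- z<m)
  c = SameColour.colour boundary
  meet : pt z (m - m) x ≡ pt (m - x) (m - m) (m - z)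
  meet = pt-cong (sym (centre-coord (sum-yxz {x} {m} {z} sum))) refl (sym (centre-coord (sum-yzx {x} {m} {z} sum)))

crease₃ : ∀ S j o {x y z} → x + y + z ≡ mid (suc j) → z ≡ side (suc j) → + 0 < x → + 0 < y →
  PairColoured (colours S (suc (suc j)) o (pt x y z))
crease₃ S j o {x} {y} sum refl 0<x 0<y = PairColoured-rotated (PairColoured-rotated (PairColoured-crease c (creaseColor (S (suc j)) o)
  (edge-crease S (suc j) o {x} {y} {m} 4F (inj₂ (inj₂ (on-line refl))))
  (edge-crease S (suc j) o {x} {y} {m} 1F (inj₂ (inj₂ (on-line refl))))
  (trans (edge-centre S (suc j) o {x} {y} {m} 5F (below₁ 5F x<m) (below₂ 5F y<m) (below-line refl)) (SameColour.at₁ boundary))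
  (trans (edge-centre S (suc j) o {x} {y} {m} 0F (below₁ 0F x<m) (below₂ 0F y<m) (below-line refl)) (SameColour.at₂ boundary))
  (trans (edge-corner₃ S (suc j) o {x} {y} {m} 2F sum (below₁ 2F x<m) (below₂ 2F y<m) (above-line refl))
         (colours-flipped S (suc j) o 3F meet (SameColour.at₂ boundary)))
  (trans (edge-corner₃ S (suc j) o {x} {y} {m} 3F sum (below₁ 3F x<m) (below₂ 3F y<m) (above-line refl))
         (colours-flipped S (suc j) o 2F meet (SameColour.at₁ boundary)))))
  where
  m = side (suc j)
  x<m = <-by-sum′ (sum-zxy {x} {y} {m} sum) refl 0<y
  y<m = <-by-sum′ (sum-zyx {x} {y} {m} sum) refl 0<x
  boundary = boundary₃ S j o (centre-sum {x} {y} {m} sum) (ℤ.+-inverseʳ m) (<⇒0<- x<m) (<⇒0<- y<m)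
  c = SameColour.colour boundary
  meet : pt y x (m - m) ≡ pt (m - x) (m - y) (m - m)
  meet = pt-cong (sym (centre-coord (sum-zxy {x} {y} {m} sum))) (sym (centre-coord (sum-zyx {x} {y} {m} sum))) refl

no-vertex-inside-T₀ : ∀ {x y z} → x + y + z ≡ mid zero → + 0 < x → + 0 < y → + 0 < z → ⊥
no-vertex-inside-T₀ {x} {y} {z} sum 0<x 0<y 0<z =
  0≰-1 (subst (+ 0 ≤_) (trans (gaps x y z) (cong (_- + 3) sum)) (0≤-+ (0≤-+ (<⇒0≤gap 0<x) (<⇒0≤gap 0<y)) (<⇒0≤gap 0<z)))
  where
  0≰-1 : ¬ (+ 0 ≤ - + 1)
  0≰-1 ()
  gaps : ∀ x y z → (x - (+ 1 + + 0)) + (y - (+ 1 + + 0)) + (z - (+ 1 + + 0)) ≡ x + y + z - + 3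
  gaps = solve-∀

inside : ∀ S j o {x y z} → x + y + z ≡ mid j → + 0 < x → + 0 < y → + 0 < z →
  PairColoured (colours S (suc j) o (pt x y z))
inside S zero o sum 0<x 0<y 0<z = ⊥-elim (no-vertex-inside-T₀ sum 0<x 0<y 0<z)
inside S (suc j) o {x} {y} {z} sum 0<x 0<y 0<z with ℤ.<-cmp x (side (suc j))
... | tri≈ _ x≡m _ = crease₁ S j o sum x≡m 0<y 0<z
... | tri> _ _ m<x = PairColoured-mirror₁ (vertex-corner₁ S (suc j) o sum m<x (ℤ.<⇒≤ 0<y) (ℤ.<⇒≤ 0<z))
  (inside S j (not o) (corner₁-sum {x} {y} {z} sum) (<⇒0<- m<x) 0<z 0<y)
... | tri< x<m _ _ with ℤ.<-cmp y (side (suc j))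
...   | tri≈ _ y≡m _ = crease₂ S j o sum y≡m 0<x 0<z
...   | tri> _ _ m<y = PairColoured-mirror₂ (vertex-corner₂ S (suc j) o sum m<y (ℤ.<⇒≤ 0<x) (ℤ.<⇒≤ 0<z))
  (inside S j (not o) (corner₂-sum {x} {y} {z} sum) 0<z (<⇒0<- m<y) 0<x)
...   | tri< y<m _ _ with ℤ.<-cmp z (side (suc j))
...     | tri≈ _ z≡m _ = crease₃ S j o sum z≡m 0<x 0<y
...     | tri> _ _ m<z = PairColoured-mirror₃ (vertex-corner₃ S (suc j) o sum m<z (ℤ.<⇒≤ 0<x) (ℤ.<⇒≤ 0<y))
  (inside S j (not o) (corner₃-sum {x} {y} {z} sum) 0<y 0<x (<⇒0<- m<z))
...     | tri< z<m _ _ = PairColoured-halfTurn (vertex-centre S (suc j) o x<m y<m z<m)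
  (inside S j o (centre-sum {x} {y} {z} sum) (<⇒0<- x<m) (<⇒0<- y<m) (<⇒0<- z<m))

Inside : ℕ → ℤ → Set
Inside k a = pow k * a < + 2 * (pow k * pow k)

isYes-witness : ∀ {A : Set} (a? : Dec A) → ⌊ a? ⌋ ≡ true → A
isYes-witness (yes a) _ = a

interior-elim : ∀ k {a b c} → interior k (pt a b c) ≡ true → Inside k a × Inside k b × Inside k c
interior-elim k {a} {b} {c} h =
  isYes-witness (pow k * a <? _) (∧-conicalˡ (test a) _ h) ,
  isYes-witness (pow k * b <? _) (∧-conicalˡ (test b) (test c) (∧-conicalʳ (test a) _ h)) ,
  isYes-witness (pow k * c <? _) (∧-conicalʳ (test b) (test c) (∧-conicalʳ (test a) _ h))
  where
  test : ℤ → Bool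
  test x = ⌊ pow k * x <? + 2 * (pow k * pow k) ⌋

interior-intro : ∀ k {a b c} → Inside k a → Inside k b → Inside k c → interior k (pt a b c) ≡ true
interior-intro k {a} {b} {c} ha hb hc
  rewrite isYes-true (pow k * a <? _) ha | isYes-true (pow k * b <? _) hb | isYes-true (pow k * c <? _) hc = refl

Inside⇒≢2pow : ∀ k {x} → Inside k x → x ≢ + 2 * pow k
Inside⇒≢2pow k h refl = ℤ.<-irrefl (double (pow k)) h
  where
  double : ∀ p → p * (+ 2 * p) ≡ + 2 * (p * p)
  double = solve-∀

-- The sides of (-2)^k T₀ are the midsegments of (-2)^(k+1) T₀, and its corners lie outside (-2)^k T₀.
run-suc : ∀ S k {a b c} o → interior k (pt a b c) ≡ true → run S (suc k) (pt a b c) o ≡ run S k (pt a b c) o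
run-suc S k {a} {b} {c} o h with interior-elim k h
... | ha , hb , hc
  rewrite isYes-false (a ≟ + 2 * pow k) (Inside⇒≢2pow k ha) | isYes-false (b ≟ + 2 * pow k) (Inside⇒≢2pow k hb)
        | isYes-false (c ≟ + 2 * pow k) (Inside⇒≢2pow k hc)
        | isYes-false (_ <? pow k * a) (ℤ.<-asym ha) | isYes-false (_ <? pow k * b) (ℤ.<-asym hb)
        | isYes-false (_ <? pow k * c) (ℤ.<-asym hc) = cong (run S k (pt a b c)) (xor-identityʳ o)

Inside-suc : ∀ k {a b c} → a + b + c ≡ + 0 → Inside k b → Inside k c → Inside (suc k) a
Inside-suc k {a} {b} {c} sum hb hc =
  0≤gap⇒< (subst (+ 0 ≤_) (gaps (pow k) a b c) (0≤-+ (0≤-+ (0≤-+ gb gb) (0≤-+ gc gc)) three))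
  where
  gb = <⇒0≤gap hb
  gc = <⇒0≤gap hc
  three : + 0 ≤ + 3 + + 2 * (pow k * (a + b + c))
  three rewrite sum | ℤ.*-zeroʳ (pow k) = +≤+ z≤n
  gaps : ∀ t a b c → (+ 2 * (t * t) - (+ 1 + t * b)) + (+ 2 * (t * t) - (+ 1 + t * b))
                     + ((+ 2 * (t * t) - (+ 1 + t * c)) + (+ 2 * (t * t) - (+ 1 + t * c)))
                     + (+ 3 + + 2 * (t * (a + b + c)))
                   ≡ + 2 * ((- + 2 * t) * (- + 2 * t)) - (+ 1 + (- + 2 * t) * a)
  gaps = solve-∀

interior-suc : ∀ k {a b c} → a + b + c ≡ + 0 → interior k (pt a b c) ≡ true → interior (suc k) (pt a b c) ≡ true
interior-suc k {a} {b} {c} sum h = interior-intro (suc k)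
  (Inside-suc k sum hb hc) (Inside-suc k (sum-yzx {a} {b} {c} sum) hc ha) (Inside-suc k (sum-zxy {a} {b} {c} sum) ha hb)
  where
  ha = proj₁ (interior-elim k h)
  hb = proj₁ (proj₂ (interior-elim k h))
  hc = proj₂ (proj₂ (interior-elim k h))

i≤+∣i∣ : ∀ i → i ≤ + ∣ i ∣
i≤+∣i∣ (+ n)    = ℤ.≤-refl
i≤+∣i∣ -[1+ n ] = -≤+

±i≤+∣i∣ : ∀ {σ} i → σ ≡ + 1 ⊎ σ ≡ - + 1 → σ * i ≤ + ∣ i ∣
±i≤+∣i∣ i (inj₁ refl) = subst (_≤ + ∣ i ∣) (sym (ℤ.*-identityˡ i)) (i≤+∣i∣ i)
±i≤+∣i∣ i (inj₂ refl) = subst₂ _≤_ (sym (ℤ.-1*i≡-i i)) (cong +_ (ℤ.∣-i∣≡∣i∣ i)) (i≤+∣i∣ (- i))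

n<2*side : ∀ n → + n < + 2 * side (suc n)
n<2*side zero    = +<+ (s≤s z≤n)
n<2*side (suc n) = 0≤gap⇒< (subst (+ 0 ≤_) (gaps (+ n) (+ 2 * side (suc n))) (0≤-+ (0≤-+ gap gap) (+≤+ z≤n)))
  where
  gap = <⇒0≤gap (n<2*side n)
  gaps : ∀ n y → (y - (+ 1 + n)) + (y - (+ 1 + n)) + n ≡ + 2 * y - (+ 1 + (+ 1 + n))
  gaps = solve-∀

Inside-if : ∀ σ m a → σ ≡ + 1 ⊎ σ ≡ - + 1 → + 0 < m → σ * a < + 2 * m → (σ * m) * a < + 2 * ((σ * m) * (σ * m))
Inside-if σ m a σ≡±1 0<m = Equivalence.from (<⇔<-by-multiple m 0<m (identity σ≡±1))
  where
  identity : σ ≡ + 1 ⊎ σ ≡ - + 1 → + 2 * ((σ * m) * (σ * m)) - (σ * m) * a ≡ m * (+ 2 * m - σ * a)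
  identity (inj₁ refl) = solve (m ∷ a ∷ [])
  identity (inj₂ refl) = solve (m ∷ a ∷ [])

Inside-large : ∀ n {a} → ∣ a ∣ ℕ.≤ n → Inside (suc n) a
Inside-large n {a} h = subst (λ p → p * a < + 2 * (p * p)) (sym (pow≡sgn*side (suc n)))
  (Inside-if (sgn (suc n)) (side (suc n)) a (sgn≡±1 (suc n)) (side-pos (suc n))
    (ℤ.≤-<-trans (±i≤+∣i∣ a (sgn≡±1 (suc n))) (ℤ.≤-<-trans (+≤+ h) (n<2*side n))))

interior-κ : ∀ e → interior (κ e) e ≡ true
interior-κ (pt a b c) = interior-intro (κ (pt a b c))
  (Inside-large N (ℕ.≤-trans (ℕ.m≤m+n ∣ a ∣ ∣ b ∣) (ℕ.m≤m+n _ ∣ c ∣)))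
  (Inside-large N (ℕ.≤-trans (ℕ.m≤n+m ∣ b ∣ ∣ a ∣) (ℕ.m≤m+n _ ∣ c ∣)))
  (Inside-large N (ℕ.m≤n+m ∣ c ∣ (∣ a ∣ ℕ.+ ∣ b ∣)))
  where
  N = ∣ a ∣ ℕ.+ ∣ b ∣ ℕ.+ ∣ c ∣

interior-≤′ : ∀ e → p₁ e + p₂ e + p₃ e ≡ + 0 → ∀ {k} → κ e ≤′ k → interior k e ≡ true
interior-≤′ e          sum ≤′-refl              = interior-κ e
interior-≤′ (pt a b c) sum {suc k} (≤′-step κ≤k) = interior-suc k sum (interior-≤′ _ sum κ≤k)

run-≤′ : ∀ S e → p₁ e + p₂ e + p₃ e ≡ + 0 → ∀ {k} → κ e ≤′ k → run S k e false ≡ run S (κ e) e false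
run-≤′ S e          sum ≤′-refl              = refl
run-≤′ S (pt a b c) sum {suc k} (≤′-step κ≤k) = trans (run-suc S k false (interior-≤′ _ sum κ≤k)) (run-≤′ S _ sum κ≤k)

P≡run : ∀ S e → p₁ e + p₂ e + p₃ e ≡ + 0 → ∀ {k} → κ e ≤′ k → P S e ≡ run S k e false
P≡run S e sum κ≤k = trans (cong (λ b → if b then run S (κ e) e false else nothing) (interior-κ e)) (sym (run-≤′ S e sum κ≤k))

Inside-toPlaneCoord : ∀ j x → Inside (suc j) (toPlaneCoord j x) ⇔ + 0 < x
Inside-toPlaneCoord j x =
  subst (λ p → (- + 2 * p) * (+ 3 * sgn j * x - + 4 * p) < + 2 * ((- + 2 * p) * (- + 2 * p)) ⇔ + 0 < x)
        (sym (pow≡sgn*side j))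
        (<⇔<-by-multiple (+ 6 * side j) (ℤ.*-monoˡ-<-pos (+ 6) (side-pos j))
           (trans (identity (sgn j) (side j) x) (sgn²-factor j _)))
  where
  identity : ∀ σ m x → + 2 * ((- + 2 * (σ * m)) * (- + 2 * (σ * m))) - (- + 2 * (σ * m)) * (+ 3 * σ * x - + 4 * (σ * m))
                       ≡ σ * σ * (+ 6 * m * (x - + 0))
  identity = solve-∀

pow-OneMod3 : ∀ j → OneMod3 (pow j)
pow-OneMod3 zero    = + 0 , refl
pow-OneMod3 (suc j) = - + 2 * c - + 1 , trans (cong (- + 2 *_) p≡3c+1) (identity c)
  where
  c = proj₁ (pow-OneMod3 j)
  p≡3c+1 = proj₂ (pow-OneMod3 j)
  identity : ∀ c → - + 2 * (+ 3 * c + + 1) ≡ + 3 * (- + 2 * c - + 1) + + 1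
  identity = solve-∀

-- The grid vertex with u_i = 3 n_i + 1 has barycentric coordinate (-1)^j (u_i + 2 (-2)^j) / 3 at level j+1.
baryCoord : ℕ → ℤ → ℤ
baryCoord j n = sgn j * (n + + 1 + + 2 * proj₁ (pow-OneMod3 j))

toBary : ℕ → Vertex → Pt
toBary j v = pt (baryCoord j (proj₁ (on₁ v))) (baryCoord j (proj₁ (on₂ v))) (baryCoord j (proj₁ (on₃ v)))

bary-sum : ∀ σ {u₁ u₂ u₃ p} ((n₁ , _) : OneMod3 u₁) ((n₂ , _) : OneMod3 u₂) ((n₃ , _) : OneMod3 u₃)
  ((c , _) : OneMod3 p) → u₁ + u₂ + u₃ ≡ + 0 →
  σ * (n₁ + + 1 + + 2 * c) + σ * (n₂ + + 1 + + 2 * c) + σ * (n₃ + + 1 + + 2 * c) ≡ + 2 * (σ * p)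
bary-sum σ (n₁ , refl) (n₂ , refl) (n₃ , refl) (c , refl) u-sum = begin
  σ * (n₁ + + 1 + + 2 * c) + σ * (n₂ + + 1 + + 2 * c) + σ * (n₃ + + 1 + + 2 * c)
    ≡⟨ regroup σ n₁ n₂ n₃ c ⟩
  σ * (n₁ + n₂ + n₃ + + 1) + + 2 * (σ * (+ 3 * c + + 1))
    ≡⟨ cong (λ t → σ * t + + 2 * (σ * (+ 3 * c + + 1))) n-sum ⟩
  σ * + 0 + + 2 * (σ * (+ 3 * c + + 1))
    ≡⟨ cong (λ t → t + + 2 * (σ * (+ 3 * c + + 1))) (ℤ.*-zeroʳ σ) ⟩
  + 0 + + 2 * (σ * (+ 3 * c + + 1))
    ≡⟨ ℤ.+-identityˡ _ ⟩
  + 2 * (σ * (+ 3 * c + + 1)) ∎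
  where
  open ≡-Reasoning
  regroup : ∀ σ n₁ n₂ n₃ c → σ * (n₁ + + 1 + + 2 * c) + σ * (n₂ + + 1 + + 2 * c) + σ * (n₃ + + 1 + + 2 * c)
                             ≡ σ * (n₁ + n₂ + n₃ + + 1) + + 2 * (σ * (+ 3 * c + + 1))
  regroup = solve-∀
  thrice : ∀ n₁ n₂ n₃ → (+ 3 * n₁ + + 1) + (+ 3 * n₂ + + 1) + (+ 3 * n₃ + + 1) ≡ + 3 * (n₁ + n₂ + n₃ + + 1)
  thrice = solve-∀
  n-sum : n₁ + n₂ + n₃ + + 1 ≡ + 0
  n-sum with ℤ.i*j≡0⇒i≡0∨j≡0 (+ 3) (trans (sym (thrice n₁ n₂ n₃)) u-sum)
  ... | inj₁ ()
  ... | inj₂ n-sum≡0 = n-sum≡0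

side≡sgn*pow : ∀ j → side j ≡ sgn j * pow j
side≡sgn*pow j = begin
  side j                     ≡⟨ sym (sgn²-factor j (side j)) ⟩
  sgn j * sgn j * side j     ≡⟨ ℤ.*-assoc (sgn j) (sgn j) (side j) ⟩
  sgn j * (sgn j * side j)   ≡⟨ cong (sgn j *_) (sym (pow≡sgn*side j)) ⟩
  sgn j * pow j              ∎
  where open ≡-Reasoning

toBary-sum : ∀ j v → p₁ (toBary j v) + p₂ (toBary j v) + p₃ (toBary j v) ≡ mid j
toBary-sum j v = trans (bary-sum (sgn j) (on₁ v) (on₂ v) (on₃ v) (pow-OneMod3 j) (sum0 v))
                       (cong (+ 2 *_) (sym (side≡sgn*pow j)))

orient : ℕ → Fin 6 → Fin 6
orient zero    s = s
orient (suc j) s = halfTurn (orient j s)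

δ-orient : ∀ j s → δ (orient j s) ≡ scale (sgn j) (δ s)
δ-orient zero    s = sym (scale-one (δ s))
  where
  scale-one : ∀ q → scale (+ 1) q ≡ q
  scale-one (pt a b c) = pt-cong (ℤ.*-identityˡ a) (ℤ.*-identityˡ b) (ℤ.*-identityˡ c)
δ-orient (suc j) s = trans (δ-halfTurn (orient j s)) (trans (cong (scale (- + 1)) (δ-orient j s)) (negate (sgn j) (δ s)))
  where
  negate : ∀ σ q → scale (- + 1) (scale σ q) ≡ scale (- σ) q
  negate σ (pt a b c) = pt-cong (identity σ a) (identity σ b) (identity σ c)
    where
    identity : ∀ σ a → - + 1 * (σ * a) ≡ - σ * a
    identity = solve-∀

PairColoured-orient : ∀ j {f g} → (∀ s → f s ≡ g (orient j s)) → PairColoured g → PairColoured f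
PairColoured-orient zero    f≡g = PairColoured-reindex (λ s → s) (λ r → r) (λ _ _ → refl) f≡g
PairColoured-orient (suc j) f≡g = PairColoured-orient j f≡g ∘ PairColoured-halfTurn (λ _ → refl)

vertex-coord : ∀ {σ u p dₚ dᵦ} → σ ≡ + 1 ⊎ σ ≡ - + 1 → ((n , _) : OneMod3 u) ((c , _) : OneMod3 p) →
  ∀ d → dₚ ≡ + 3 * d → dᵦ ≡ σ * d → + 2 * u + dₚ ≡ + 3 * σ * (+ 2 * (σ * (n + + 1 + + 2 * c)) + dᵦ) - + 4 * p
vertex-coord (inj₁ refl) (n , refl) (c , refl) d refl refl = solve (n ∷ c ∷ d ∷ [])
vertex-coord (inj₂ refl) (n , refl) (c , refl) d refl refl = solve (n ∷ c ∷ d ∷ [])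

edgeAt≡toPlane : ∀ j v s → edgeAt v s ≡ toPlane j (edgeB (toBary j v) (orient j s))
edgeAt≡toPlane j v s = pt-cong
  (vertex-coord (sgn≡±1 j) (on₁ v) (pow-OneMod3 j) _ (cong p₁ (dir≡3δ s)) (cong p₁ (δ-orient j s)))
  (vertex-coord (sgn≡±1 j) (on₂ v) (pow-OneMod3 j) _ (cong p₂ (dir≡3δ s)) (cong p₂ (δ-orient j s)))
  (vertex-coord (sgn≡±1 j) (on₃ v) (pow-OneMod3 j) _ (cong p₃ (dir≡3δ s)) (cong p₃ (δ-orient j s)))

edgeAt-sum : ∀ v s → p₁ (edgeAt v s) + p₂ (edgeAt v s) + p₃ (edgeAt v s) ≡ + 0
edgeAt-sum v s = trans (regroup-edge (u₁ v) (u₂ v) (u₃ v) _ _ _) (cong₂ (λ u d → + 2 * u + d) (sum0 v) (dir-sum s))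
  where
  dir-sum : ∀ s → p₁ (dir s) + p₂ (dir s) + p₃ (dir s) ≡ + 0
  dir-sum = Fin6-elim refl refl refl refl refl refl

0<2x+0⇒0<x : ∀ {x d} → d ≡ + 0 → + 0 < + 2 * x + d → + 0 < x
0<2x+0⇒0<x {x} refl = Equivalence.to (<⇔<-by-multiple (+ 2) (+<+ (s≤s z≤n)) (identity x))
  where
  identity : ∀ x → + 2 * x + + 0 - + 0 ≡ + 2 * (x - + 0)
  identity = solve-∀

toBary-positive : ∀ j v → (∀ s → interior (suc j) (edgeAt v s) ≡ true) →
  + 0 < p₁ (toBary j v) × + 0 < p₂ (toBary j v) × + 0 < p₃ (toBary j v)
toBary-positive j v inner =
  0<2x+0⇒0<x (trans (cong p₁ (δ-orient j 0F)) (ℤ.*-zeroʳ (sgn j))) (positive (proj₁ (interior-elim (suc j) (edge-inside 0F)))) ,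
  0<2x+0⇒0<x (trans (cong p₂ (δ-orient j 2F)) (ℤ.*-zeroʳ (sgn j))) (positive (proj₁ (proj₂ (interior-elim (suc j) (edge-inside 2F))))) ,
  0<2x+0⇒0<x (trans (cong p₃ (δ-orient j 1F)) (ℤ.*-zeroʳ (sgn j))) (positive (proj₂ (proj₂ (interior-elim (suc j) (edge-inside 1F)))))
  where
  edge-inside : ∀ s → interior (suc j) (toPlane j (edgeB (toBary j v) (orient j s))) ≡ true
  edge-inside s = subst (λ e → interior (suc j) e ≡ true) (edgeAt≡toPlane j v s) (inner s)
  positive : ∀ {x} → Inside (suc j) (toPlaneCoord j x) → + 0 < x
  positive = Equivalence.to (Inside-toPlaneCoord j _)

pairColour-start : ∀ r c → pairColour r c r ≡ c
pairColour-start r c rewrite isYes-true (r Fin.≟ r) refl = refl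

pairColour-next : ∀ r c → pairColour r c (next r) ≡ c
pairColour-next r c rewrite isYes-true (next r Fin.≟ next r) refl | ∨-zeroʳ ⌊ next r Fin.≟ r ⌋ = refl

pairColour-other : ∀ r c s → ¬ s ≡ r → ¬ s ≡ next r → pairColour r c s ≡ flip c
pairColour-other r c s s≢r s≢r+1 rewrite isYes-false (s Fin.≟ r) s≢r | isYes-false (s Fin.≟ next r) s≢r+1 = refl

PairColoured⇒pair : ∀ {f} → PairColoured f →
  Σ (Fin 6) λ r → Σ Color λ c →
    ((s : Fin 6) → s ≡ r ⊎ s ≡ next r → f s ≡ just c) × ((s : Fin 6) → ¬ s ≡ r → ¬ s ≡ next r → f s ≡ just (flip c))
PairColoured⇒pair (pairColoured r c f≡) = r , c , pair , others
  where
  pair : ∀ s → s ≡ r ⊎ s ≡ next r → _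
  pair s (inj₁ refl) = trans (f≡ s) (cong just (pairColour-start r c))
  pair s (inj₂ refl) = trans (f≡ s) (cong just (pairColour-next r c))
  others : ∀ s → ¬ s ≡ r → ¬ s ≡ next r → _
  others s s≢r s≢r+1 = trans (f≡ s) (cong just (pairColour-other r c s s≢r s≢r+1))

≤-sum : ∀ {n} (f : Fin (suc n) → ℕ) i → f i ℕ.≤ sum f
≤-sum f i = subst (f i ℕ.≤_) (sym (sum-remove {i = i} f)) (ℕ.m≤m+n _ _)

lemma3p4 : (S : Seq) (v : Vertex) →
    Σ (Fin 6) (λ r → Σ Color (λ c →
    ((s : Fin 6) → s ≡ r ⊎ s ≡ next r → P S (edgeAt v s) ≡ just c) ×
    ((s : Fin 6) → ¬ s ≡ r → ¬ s ≡ next r → P S (edgeAt v s) ≡ just (flip c))))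
lemma3p4 S v = PairColoured⇒pair (PairColoured-orient B edge-colour
  (inside S B false (toBary-sum B v) 0<x 0<y 0<z))
  where
  B = sum (λ s → κ (edgeAt v s))
  κ≤B+1 : ∀ s → κ (edgeAt v s) ≤′ suc B
  κ≤B+1 s = ℕ.≤⇒≤′ (ℕ.m≤n⇒m≤1+n (≤-sum (λ s → κ (edgeAt v s)) s))
  edge-colour : ∀ s → P S (edgeAt v s) ≡ colours S (suc B) false (toBary B v) (orient B s)
  edge-colour s = begin
    P S (edgeAt v s)                                               ≡⟨ P≡run S (edgeAt v s) (edgeAt-sum v s) (κ≤B+1 s) ⟩
    run S (suc B) (edgeAt v s) false                               ≡⟨ cong (λ e → run S (suc B) e false) (edgeAt≡toPlane B v s) ⟩
    run S (suc B) (toPlane B (edgeB (toBary B v) (orient B s))) false ≡⟨ run-toPlane S B _ false ⟩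
    colours S (suc B) false (toBary B v) (orient B s)              ∎
    where open ≡-Reasoning
  positive = toBary-positive B v (λ s → interior-≤′ (edgeAt v s) (edgeAt-sum v s) (κ≤B+1 s))
  0<x = proj₁ positive
  0<y = proj₁ (proj₂ positive)
  0<z = proj₂ (proj₂ positive)
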